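{- There is a constant $C>0$ such that for all positive integers $n,m$, $$\sqrt{4mn-2(m+n)+\tfrac14}+\tfrac12\ \le\ \mathrm{M}_2(n,m)\ \le\ 2\sqrt{2}\sqrt{mn}+C(\sqrt{n}+\sqrt{m}).$$
   Context: A complete sparse ruler of length $n$ and height $m$ in two dimensions (an $(n,m)$-ruler) is a subset $R\subseteq\{0,1,\dots,n-1\}\times\{0,1,\dots,m-1\}$ such that for every $(x,y)\in\mathbb{Z}^2$ with $|x|\le n-1$ and $|y|\le m-1$ there exist $r_1,r_2\in R$ with $r_1-r_2=(x,y)$. $\mathrm{M}_2(n,m)$ denotes the minimum number of elements of an $(n,m)$-ruler. -}

module Defs where

open import Data.Nat using (ℕ; zero; suc; _+_; _*_; _<_; _≤_; _≤ᵇ_)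
open import Data.Bool using (if_then_else_)
open import Data.Integer as ℤ using (ℤ; +_; ∣_∣)
open import Data.Product using (Σ; ∃₂; _×_; _,_; proj₁; proj₂)
open import Data.List using (List; length)
open import Data.List.Relation.Unary.All using (All)
open import Data.List.Relation.Unary.Unique.Propositional using (Unique)
open import Data.List.Membership.Propositional using (_∈_)
open import Relation.Binary.PropositionalEquality using (_≡_)

isqrt : ℕ → ℕ
isqrt zero = zero
isqrt (suc k) with isqrt k
... | s = if (suc s * suc s) ≤ᵇ suc k then suc s else s

Point : Set
Point = ℕ × ℕ

IsRuler : ℕ → ℕ → List Point → Set
IsRuler n m R =
  All (λ p → proj₁ p < n × proj₂ p < m) R ×
  (∀ (x y : ℤ) → ∣ x ∣ < n → ∣ y ∣ < m →
     ∃₂ λ (r₁ r₂ : Point) → r₁ ∈ R × r₂ ∈ R ×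
       ((+ proj₁ r₁) ℤ.- (+ proj₁ r₂) ≡ x) ×
       ((+ proj₂ r₁) ℤ.- (+ proj₂ r₂) ≡ y))

-- M is M₂(n,m): the minimum number of elements of an (n,m)-ruler.
-- Finite sets are represented by duplicate-free lists; |R| = length R.
IsM₂ : ℕ → ℕ → ℕ → Set
IsM₂ n m M =
  (Σ (List Point) λ R → Unique R × IsRuler n m R × length R ≡ M) ×
  (∀ (R : List Point) → Unique R → IsRuler n m R → M ≤ length R)

{-# OPTIONS --safe #-}
module Submission where

-- Lower bound: the (2n−1)(2m−1) differences a ruler must realise are among (0,0) and
-- the M(M−1) differences of ordered pairs of distinct elements.
-- Upper bound: if every a ∈ [0,n) is s − t with s ∈ A, t ∈ B, and every b ∈ [0,m) is
-- both c − d and d − c with c ∈ C, d ∈ D, then (A × C) ∪ (B × D) is an (n,m)-ruler.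
-- Take for A the top √n points of [0,n) and for B the multiples of √n below n; for C
-- the bottom and top √(m/2) points of [0,m) and for D the multiples of √(m/2) plus m−1.
-- This gives a ruler with about 2√n · √(2m) = 2√2 · √(mn) points.

open import Defs
open import Data.Nat using (ℕ; _+_; _*_; _<_; _≤_)
open import Data.Product using (Σ; _×_)

open import Data.Bool using (true; false) renaming (T to IsTrue)
open import Data.Empty using (⊥-elim)
open import Data.Integer as ℤ using (ℤ; +_; -[1+_]; ∣_∣)
open import Data.Integer.Properties using (+-inverseʳ; [+m]-[+n]≡m⊖n; ⊖-≥; ⊖-<)
open import Data.List using (List; []; _∷_; _++_; map; upTo; length; filter; deduplicate; cartesianProduct)
open import Data.List.Properties using (length-++; length-map; length-upTo; length-filter; length-deduplicate)
open import Data.List.Membership.Propositional using (_∈_)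
open import Data.List.Membership.Propositional.Properties
open import Data.List.Relation.Binary.Subset.Propositional using (_⊆_)
open import Data.List.Relation.Unary.All as All using (All; []; _∷_)
open import Data.List.Relation.Unary.AllPairs using (_∷_; [])
open import Data.List.Relation.Unary.Any using (here; there)
open import Data.List.Relation.Unary.Unique.Propositional using (Unique)
open import Data.List.Relation.Unary.Unique.Propositional.Properties using (cartesianProduct⁺)
open import Data.List.Relation.Unary.Unique.DecPropositional.Properties using (deduplicate-!)
open import Data.Nat.Base using (suc; zero; z≤n; s≤s; z<s; _∸_; ⌊_/2⌋; _≤ᵇ_)
open import Data.Nat.DivMod using (_/_; _%_; m≡m%n+[m/n]*n; m%n<n; m/n*n≤m)
open import Data.Nat.Properties
open import Data.Nat.Tactic.RingSolver using (solve-∀)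
open import Data.Product using (∃₂; _,_; proj₁; proj₂; uncurry)
open import Data.Product.Properties using (≡-dec)
open import Data.Sum using (_⊎_; inj₁; inj₂)
open import Relation.Binary.Definitions using (DecidableEquality)
open import Relation.Binary.PropositionalEquality
open import Relation.Nullary using (Dec; yes; no)
open import Relation.Nullary.Decidable using (_×-dec_)
open import Relation.Unary using (Decidable)

isqrt-spec : ∀ k → isqrt k * isqrt k ≤ k × k < suc (isqrt k) * suc (isqrt k)
isqrt-spec zero = z≤n , z<s
isqrt-spec (suc k) with isqrt k | isqrt-spec k
... | s | lo , hi with suc s * suc s ≤ᵇ suc k in test
... | true  = ≤ᵇ⇒≤ (suc s * suc s) (suc k) (subst IsTrue (sym test) _) ,
              ≤-trans (s≤s hi) (*-mono-< (n<1+n (suc s)) (n<1+n (suc s)))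
... | false = m≤n⇒m≤1+n lo , ≰⇒> (λ le → subst IsTrue test (≤⇒≤ᵇ le))

isqrt*isqrt≤ : ∀ k → isqrt k * isqrt k ≤ k
isqrt*isqrt≤ k = proj₁ (isqrt-spec k)

<[1+isqrt]² : ∀ k → k < suc (isqrt k) * suc (isqrt k)
<[1+isqrt]² k = proj₂ (isqrt-spec k)

x*x<y*y⇒x<y : ∀ {x y} → x * x < y * y → x < y
x*x<y*y⇒x<y {x} {y} lt with x <? y
... | yes x<y = x<y
... | no x≮y  = ⊥-elim (<⇒≱ lt (*-mono-≤ (≮⇒≥ x≮y) (≮⇒≥ x≮y)))

≤isqrt : ∀ {x k} → x * x ≤ k → x ≤ isqrt k
≤isqrt {x} {k} le = <⇒≤pred (x*x<y*y⇒x<y (≤-<-trans le (<[1+isqrt]² k)))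

isqrt*isqrt≤isqrt-* : ∀ a b → isqrt a * isqrt b ≤ isqrt (a * b)
isqrt*isqrt≤isqrt-* a b = ≤isqrt (begin
  (isqrt a * isqrt b) * (isqrt a * isqrt b) ≡⟨ square-* (isqrt a) (isqrt b) ⟩
  (isqrt a * isqrt a) * (isqrt b * isqrt b) ≤⟨ *-mono-≤ (isqrt*isqrt≤ a) (isqrt*isqrt≤ b) ⟩
  a * b                                     ∎)
  where
  open ≤-Reasoning
  square-* : ∀ x y → (x * y) * (x * y) ≡ (x * x) * (y * y)
  square-* = solve-∀

isqrt[2*]≤1+2*isqrt : ∀ m → isqrt (2 * m) ≤ suc (2 * isqrt m)
isqrt[2*]≤1+2*isqrt m = ≤-pred (subst (isqrt (2 * m) <_) (double-suc q) (x*x<y*y⇒x<y (begin-strict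
  w * w                     ≤⟨ isqrt*isqrt≤ (2 * m) ⟩
  2 * m                     <⟨ *-monoʳ-< 2 (<[1+isqrt]² m) ⟩
  2 * (suc q * suc q)       ≤⟨ m≤m+n (2 * (suc q * suc q)) (2 * (suc q * suc q)) ⟩
  2 * (suc q * suc q) + 2 * (suc q * suc q) ≡⟨ four-squares (suc q) ⟩
  (2 * suc q) * (2 * suc q) ∎)))
  where
  open ≤-Reasoning
  q = isqrt m
  w = isqrt (2 * m)
  four-squares : ∀ x → 2 * (x * x) + 2 * (x * x) ≡ (2 * x) * (2 * x)
  four-squares = solve-∀
  double-suc : ∀ x → 2 * suc x ≡ suc (suc (2 * x))
  double-suc = solve-∀

⌊n/2⌋+⌊n/2⌋≤n : ∀ n → ⌊ n /2⌋ + ⌊ n /2⌋ ≤ n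
⌊n/2⌋+⌊n/2⌋≤n n = subst (⌊ n /2⌋ + ⌊ n /2⌋ ≤_) (⌊n/2⌋+⌈n/2⌉≡n n)
  (+-monoʳ-≤ ⌊ n /2⌋ (⌊n/2⌋≤⌈n/2⌉ n))

n≤1+⌊n/2⌋+⌊n/2⌋ : ∀ n → n ≤ suc (⌊ n /2⌋ + ⌊ n /2⌋)
n≤1+⌊n/2⌋+⌊n/2⌋ n = subst (_≤ suc (⌊ n /2⌋ + ⌊ n /2⌋)) (⌊n/2⌋+⌈n/2⌉≡n n)
  (≤-trans (+-monoʳ-≤ ⌊ n /2⌋ (⌊n/2⌋-mono (n≤1+n (suc n)))) (≤-reflexive (+-suc ⌊ n /2⌋ ⌊ n /2⌋)))

length-cartesianProduct : ∀ {A B : Set} (xs : List A) (ys : List B) →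
                          length (cartesianProduct xs ys) ≡ length xs * length ys
length-cartesianProduct []       ys = refl
length-cartesianProduct (x ∷ xs) ys = begin
  length (map (x ,_) ys ++ cartesianProduct xs ys)      ≡⟨ length-++ (map (x ,_) ys) ⟩
  length (map (x ,_) ys) + length (cartesianProduct xs ys)
    ≡⟨ cong₂ _+_ (length-map (x ,_) ys) (length-cartesianProduct xs ys) ⟩
  length ys + length xs * length ys                      ∎
  where open ≡-Reasoning

Unique-⊆⇒length≤ : ∀ {A : Set} {xs ys : List A} → Unique xs → xs ⊆ ys → length xs ≤ length ys
Unique-⊆⇒length≤ {xs = []}     _                 _   = z≤n
Unique-⊆⇒length≤ {xs = x ∷ xs} (x∉xs ∷ unique-xs) x∷xs⊆ys with ∈-∃++ (x∷xs⊆ys (here refl))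
... | us , vs , refl = subst (suc (length xs) ≤_) (sym length-us++x∷vs)
                         (s≤s (Unique-⊆⇒length≤ unique-xs xs⊆us++vs))
  where
  length-us++x∷vs : length (us ++ x ∷ vs) ≡ suc (length (us ++ vs))
  length-us++x∷vs = trans (length-++ us)
    (trans (+-suc (length us) (length vs)) (cong suc (sym (length-++ us))))
  xs⊆us++vs : xs ⊆ us ++ vs
  xs⊆us++vs y∈xs with ∈-++⁻ us (x∷xs⊆ys (there y∈xs))
  ... | inj₁ y∈us         = ∈-++⁺ˡ y∈us
  ... | inj₂ (here y≡x)   = ⊥-elim (All.lookup x∉xs y∈xs (sym y≡x))
  ... | inj₂ (there y∈vs) = ∈-++⁺ʳ us y∈vs

offDiagonal : ∀ {A : Set} → List A → List (A × A)
offDiagonal []       = []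
offDiagonal (x ∷ xs) = map (x ,_) xs ++ map (_, x) xs ++ offDiagonal xs

∈-offDiagonal⁺ : ∀ {A : Set} {xs : List A} {x y} → x ∈ xs → y ∈ xs → x ≢ y → (x , y) ∈ offDiagonal xs
∈-offDiagonal⁺ (here refl) (here refl) x≢y = ⊥-elim (x≢y refl)
∈-offDiagonal⁺ {x = x} (here refl) (there y∈xs) _ = ∈-++⁺ˡ (∈-map⁺ (x ,_) y∈xs)
∈-offDiagonal⁺ {xs = _ ∷ xs} {y = y} (there x∈xs) (here refl) _ =
  ∈-++⁺ʳ (map _ xs) (∈-++⁺ˡ (∈-map⁺ (_, y) x∈xs))
∈-offDiagonal⁺ {xs = _ ∷ xs} (there x∈xs) (there y∈xs) x≢y =
  ∈-++⁺ʳ (map _ xs) (∈-++⁺ʳ (map _ xs) (∈-offDiagonal⁺ x∈xs y∈xs x≢y))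

length-offDiagonal : ∀ {A : Set} (xs : List A) →
                     length (offDiagonal xs) + length xs ≡ length xs * length xs
length-offDiagonal []       = refl
length-offDiagonal (x ∷ xs) = begin
  length (offDiagonal (x ∷ xs)) + suc L       ≡⟨ cong (_+ suc L) length-offDiagonal-∷ ⟩
  (L + (L + length (offDiagonal xs))) + suc L ≡⟨ regroup L (length (offDiagonal xs)) ⟩
  suc (L + L) + (length (offDiagonal xs) + L) ≡⟨ cong (_+_ (suc (L + L))) (length-offDiagonal xs) ⟩
  suc (L + L) + L * L                         ≡⟨ square-suc L ⟩
  suc L * suc L                               ∎
  where
  open ≡-Reasoning
  L = length xs
  length-offDiagonal-∷ : length (offDiagonal (x ∷ xs)) ≡ L + (L + length (offDiagonal xs))
  length-offDiagonal-∷ = trans (length-++ (map (x ,_) xs))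
    (cong₂ _+_ (length-map _ xs)
      (trans (length-++ (map (_, x) xs)) (cong (_+ length (offDiagonal xs)) (length-map _ xs))))
  regroup : ∀ l o → (l + (l + o)) + suc l ≡ suc (l + l) + (o + l)
  regroup = solve-∀
  square-suc : ∀ l → suc (l + l) + l * l ≡ suc l * suc l
  square-suc = solve-∀

absAtMost : ℕ → List ℤ
absAtMost zero    = + 0 ∷ []
absAtMost (suc k) = + suc k ∷ -[1+ k ] ∷ absAtMost k

∈-absAtMost⁻ : ∀ k {x} → x ∈ absAtMost k → ∣ x ∣ ≤ k
∈-absAtMost⁻ zero    (here refl)         = z≤n
∈-absAtMost⁻ (suc k) (here refl)         = ≤-refl
∈-absAtMost⁻ (suc k) (there (here refl)) = ≤-refl
∈-absAtMost⁻ (suc k) (there (there x∈))  = m≤n⇒m≤1+n (∈-absAtMost⁻ k x∈)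

absAtMost-Unique : ∀ k → Unique (absAtMost k)
absAtMost-Unique zero    = [] ∷ []
absAtMost-Unique (suc k) = All.tabulate +suc-k∉ ∷ All.tabulate -suc-k∉ ∷ absAtMost-Unique k
  where
  +suc-k∉ : ∀ {y} → y ∈ -[1+ k ] ∷ absAtMost k → + suc k ≢ y
  +suc-k∉ (here refl) ()
  +suc-k∉ (there y∈)  refl = 1+n≰n (∈-absAtMost⁻ k y∈)
  -suc-k∉ : ∀ {y} → y ∈ absAtMost k → -[1+ k ] ≢ y
  -suc-k∉ y∈ refl = 1+n≰n (∈-absAtMost⁻ k y∈)

length-absAtMost : ∀ k → length (absAtMost k) ≡ suc (k + k)
length-absAtMost zero    = refl
length-absAtMost (suc k) = cong (λ l → suc (suc l)) (trans (length-absAtMost k) (sym (+-suc k k)))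

_≟ₚ_ : DecidableEquality Point
_≟ₚ_ = ≡-dec _≟_ _≟_

difference : Point → Point → ℤ × ℤ
difference r₁ r₂ = (+ proj₁ r₁ ℤ.- + proj₁ r₂) , (+ proj₂ r₁ ℤ.- + proj₂ r₂)

differences : List Point → List (ℤ × ℤ)
differences R = (+ 0 , + 0) ∷ map (uncurry difference) (offDiagonal R)

difference-self : ∀ r → difference r r ≡ (+ 0 , + 0)
difference-self r = cong₂ _,_ (+-inverseʳ (+ proj₁ r)) (+-inverseʳ (+ proj₂ r))

∈-differences : ∀ {R r₁ r₂} → r₁ ∈ R → r₂ ∈ R → difference r₁ r₂ ∈ differences R
∈-differences {r₁ = r₁} {r₂} r₁∈ r₂∈ with r₁ ≟ₚ r₂
... | yes refl = here (difference-self r₁)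
... | no r₁≢r₂ = there (∈-map⁺ (uncurry difference) (∈-offDiagonal⁺ r₁∈ r₂∈ r₁≢r₂))

length-differences : ∀ R → length (differences R) + length R ≡ suc (length R * length R)
length-differences R =
  cong suc (trans (cong (_+ length R) (length-map (uncurry difference) (offDiagonal R)))
                  (length-offDiagonal R))

ruler⇒length-differences : ∀ {n m R} → IsRuler (suc n) (suc m) R →
                           suc (n + n) * suc (m + m) ≤ length (differences R)
ruler⇒length-differences {n} {m} {R} (_ , covers) = begin
  suc (n + n) * suc (m + m) ≡⟨ sym (trans (length-cartesianProduct (absAtMost n) (absAtMost m))
                                   (cong₂ _*_ (length-absAtMost n) (length-absAtMost m))) ⟩
  length box                ≤⟨ Unique-⊆⇒length≤ (cartesianProduct⁺ (absAtMost-Unique n) (absAtMost-Unique m))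
                                                  box⊆differences ⟩
  length (differences R)    ∎
  where
  open ≤-Reasoning
  box : List (ℤ × ℤ)
  box = cartesianProduct (absAtMost n) (absAtMost m)
  box⊆differences : box ⊆ differences R
  box⊆differences {x , y} xy∈box with ∈-cartesianProduct⁻ (absAtMost n) (absAtMost m) xy∈box
  ... | x∈ , y∈ with covers x y (s≤s (∈-absAtMost⁻ n x∈)) (s≤s (∈-absAtMost⁻ m y∈))
  ... | r₁ , r₂ , r₁∈ , r₂∈ , refl , refl = ∈-differences r₁∈ r₂∈

ruler-nonempty : ∀ {n m R} → 0 < n → 0 < m → IsRuler n m R → 0 < length R
ruler-nonempty 0<n 0<m (_ , covers) with covers (+ 0) (+ 0) 0<n 0<m
... | _ , _ , r₁∈ , _ = ∈-length r₁∈

ruler-length-lower-bound : ∀ {n m R} → 0 < n → 0 < m → IsRuler n m R →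
                           4 * m * n + length R ≤ length R * length R + 2 * (m + n)
ruler-length-lower-bound {suc n} {suc m} {R} _ _ ruler = ≤-pred (begin
  suc (4 * suc m * suc n + L)                              ≡⟨ expand n m L ⟩
  suc (n + n) * suc (m + m) + L + 2 * (suc m + suc n)
    ≤⟨ +-monoˡ-≤ (2 * (suc m + suc n)) (+-monoˡ-≤ L (ruler⇒length-differences ruler)) ⟩
  length (differences R) + L + 2 * (suc m + suc n)
    ≡⟨ cong (_+ 2 * (suc m + suc n)) (length-differences R) ⟩
  suc (L * L + 2 * (suc m + suc n))                        ∎)
  where
  open ≤-Reasoning
  L = length R
  expand : ∀ n m l → suc (4 * suc m * suc n + l) ≡ suc (n + n) * suc (m + m) + l + 2 * (suc m + suc n)
  expand = solve-∀

[+s]-[+t]≡+a : ∀ {s a t} → s ≡ a + t → + s ℤ.- + t ≡ + a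
[+s]-[+t]≡+a {_} {a} {t} refl = begin
  + (a + t) ℤ.- + t ≡⟨ [+m]-[+n]≡m⊖n (a + t) t ⟩
  (a + t) ℤ.⊖ t     ≡⟨ ⊖-≥ (m≤n+m t a) ⟩
  + (a + t ∸ t)     ≡⟨ cong +_ (m+n∸n≡m a t) ⟩
  + a               ∎
  where open ≡-Reasoning

[+t]-[+s]≡-[1+a] : ∀ {s a t} → s ≡ suc a + t → + t ℤ.- + s ≡ -[1+ a ]
[+t]-[+s]≡-[1+a] {_} {a} {t} refl = begin
  + t ℤ.- + (suc a + t)  ≡⟨ [+m]-[+n]≡m⊖n t (suc a + t) ⟩
  t ℤ.⊖ (suc a + t)      ≡⟨ ⊖-< (s≤s (m≤n+m t a)) ⟩
  ℤ.- + (suc a + t ∸ t)  ≡⟨ cong (λ k → ℤ.- + k) (m+n∸n≡m (suc a) t) ⟩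
  -[1+ a ]               ∎
  where open ≡-Reasoning

DiffCover : List ℕ → List ℕ → ℕ → Set
DiffCover A B n = ∀ {a} → a < n → ∃₂ λ s t → s ∈ A × t ∈ B × s < n × s ≡ a + t

DiffWitness : List ℕ → List ℕ → ℕ → ℤ → Set
DiffWitness A B n z = ∃₂ λ s t → s ∈ A × t ∈ B × s < n × t < n × + s ℤ.- + t ≡ z

DiffCover-mono : ∀ {A A′ B B′ n} → A ⊆ A′ → B ⊆ B′ → DiffCover A B n → DiffCover A′ B′ n
DiffCover-mono A⊆A′ B⊆B′ cover a<n with cover a<n
... | s , t , s∈A , t∈B , s<n , s≡a+t = s , t , A⊆A′ s∈A , B⊆B′ t∈B , s<n , s≡a+t

witness⁺ : ∀ {A B n a} → DiffCover A B n → a < n → DiffWitness A B n (+ a)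
witness⁺ {a = a} cover a<n with cover a<n
... | s , t , s∈A , t∈B , s<n , s≡a+t =
  s , t , s∈A , t∈B , s<n , ≤-<-trans (m≤n+m t a) (subst (_< _) s≡a+t s<n) , [+s]-[+t]≡+a s≡a+t

witness⁻ : ∀ {A B n a} → DiffCover B A n → suc a < n → DiffWitness A B n -[1+ a ]
witness⁻ {a = a} cover a<n with cover a<n
... | t , s , t∈B , s∈A , t<n , t≡a+s =
  s , t , s∈A , t∈B , ≤-<-trans (m≤n+m s (suc a)) (subst (_< _) t≡a+s t<n) , t<n , [+t]-[+s]≡-[1+a] t≡a+s

witness : ∀ {A B n z} → DiffCover A B n → DiffCover B A n → ∣ z ∣ < n → DiffWitness A B n z
witness {z = + a}      AB _  = witness⁺ AB
witness {z = -[1+ a ]} _  BA = witness⁻ BA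

witness-either : ∀ {A B n z} → DiffCover A B n → ∣ z ∣ < n → DiffWitness A B n z ⊎ DiffWitness B A n z
witness-either {z = + a}      AB hz = inj₁ (witness⁺ AB hz)
witness-either {z = -[1+ a ]} AB hz = inj₂ (witness⁻ AB hz)

InBox : ℕ → ℕ → Point → Set
InBox n m p = proj₁ p < n × proj₂ p < m

inBox? : ∀ n m → Decidable (InBox n m)
inBox? n m p = (proj₁ p <? n) ×-dec (proj₂ p <? m)

restrict : ℕ → ℕ → List Point → List Point
restrict n m L = deduplicate _≟ₚ_ (filter (inBox? n m) L)

restrict-Unique : ∀ n m L → Unique (restrict n m L)
restrict-Unique n m L = deduplicate-! _≟ₚ_ (filter (inBox? n m) L)

restrict-InBox : ∀ n m L → All (InBox n m) (restrict n m L)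
restrict-InBox n m L = All.tabulate λ p∈ →
  proj₂ (∈-filter⁻ (inBox? n m) {xs = L} (∈-deduplicate⁻ _≟ₚ_ (filter (inBox? n m) L) p∈))

∈-restrict⁺ : ∀ {n m L p} → p ∈ L → InBox n m p → p ∈ restrict n m L
∈-restrict⁺ {n} {m} p∈L p∈box = ∈-deduplicate⁺ _≟ₚ_ (∈-filter⁺ (inBox? n m) p∈L p∈box)

length-restrict≤ : ∀ n m L → length (restrict n m L) ≤ length L
length-restrict≤ n m L = ≤-trans (length-deduplicate _≟ₚ_ (filter (inBox? n m) L))
                                 (length-filter (inBox? n m) L)

product-ruler : ∀ {n m A B C D} → DiffCover A B n → DiffCover C D m → DiffCover D C m →
                IsRuler n m (restrict n m (cartesianProduct A C ++ cartesianProduct B D))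
product-ruler {n} {m} {A} {B} {C} {D} AB CD DC = restrict-InBox n m L , covers
  where
  L = cartesianProduct A C ++ cartesianProduct B D
  covers : ∀ x y → ∣ x ∣ < n → ∣ y ∣ < m → ∃₂ λ r₁ r₂ → r₁ ∈ restrict n m L × r₂ ∈ restrict n m L ×
             (+ proj₁ r₁ ℤ.- + proj₁ r₂ ≡ x) × (+ proj₂ r₁ ℤ.- + proj₂ r₂ ≡ y)
  covers x y hx hy with witness-either AB hx
  ... | inj₁ (s , t , s∈A , t∈B , s<n , t<n , ex) with witness CD DC hy
  ...   | c , d , c∈C , d∈D , c<m , d<m , ey =
    (s , c) , (t , d) ,
    ∈-restrict⁺ (∈-++⁺ˡ (∈-cartesianProduct⁺ s∈A c∈C)) (s<n , c<m) ,
    ∈-restrict⁺ (∈-++⁺ʳ (cartesianProduct A C) (∈-cartesianProduct⁺ t∈B d∈D)) (t<n , d<m) , ex , ey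
  covers x y hx hy | inj₂ (t , s , t∈B , s∈A , t<n , s<n , ex) with witness DC CD hy
  ...   | d , c , d∈D , c∈C , d<m , c<m , ey =
    (t , d) , (s , c) ,
    ∈-restrict⁺ (∈-++⁺ʳ (cartesianProduct A C) (∈-cartesianProduct⁺ t∈B d∈D)) (t<n , d<m) ,
    ∈-restrict⁺ (∈-++⁺ˡ (∈-cartesianProduct⁺ s∈A c∈C)) (s<n , c<m) , ex , ey

length-product-ruler : ∀ n m (A B C D : List ℕ) →
  length (restrict n m (cartesianProduct A C ++ cartesianProduct B D))
    ≤ length A * length C + length B * length D
length-product-ruler n m A B C D = begin
  length (restrict n m (cartesianProduct A C ++ cartesianProduct B D))
    ≤⟨ length-restrict≤ n m (cartesianProduct A C ++ cartesianProduct B D) ⟩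
  length (cartesianProduct A C ++ cartesianProduct B D)
    ≡⟨ length-++ (cartesianProduct A C) ⟩
  length (cartesianProduct A C) + length (cartesianProduct B D)
    ≡⟨ cong₂ _+_ (length-cartesianProduct A C) (length-cartesianProduct B D) ⟩
  length A * length C + length B * length D ∎
  where open ≤-Reasoning

topSegment : ℕ → ℕ → List ℕ
topSegment N α = map (N ∸_) (upTo α)

multiples : ℕ → ℕ → List ℕ
multiples g β = map (_* g) (upTo β)

length-topSegment : ∀ N α → length (topSegment N α) ≡ α
length-topSegment N α = trans (length-map (N ∸_) (upTo α)) (length-upTo α)

length-multiples : ∀ g β → length (multiples g β) ≡ β
length-multiples g β = trans (length-map (_* g) (upTo β)) (length-upTo β)

topSegment-multiples-DiffCover : ∀ N g β → suc N ≤ β * suc g →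
                                 DiffCover (topSegment N (suc g)) (multiples (suc g) β) (suc N)
topSegment-multiples-DiffCover N g β N<βγ {a} (s≤s a≤N) =
  N ∸ i , j * γ , ∈-map⁺ (N ∸_) (∈-upTo⁺ (m%n<n e γ)) , ∈-map⁺ (_* γ) (∈-upTo⁺ j<β) ,
  s≤s (m∸n≤m N i) , N∸i≡a+jγ
  where
  γ = suc g
  e = N ∸ a
  i = e % γ
  j = e / γ
  j<β : j < β
  j<β = *-cancelʳ-< γ j β (begin-strict
    j * γ ≤⟨ m/n*n≤m e γ ⟩
    e     ≤⟨ m∸n≤m N a ⟩
    N     <⟨ N<βγ ⟩
    β * γ ∎)
    where open ≤-Reasoning
  N∸i≡a+jγ : N ∸ i ≡ a + j * γ
  N∸i≡a+jγ = begin
    N ∸ i                 ≡⟨ cong (_∸ i) (m+[n∸m]≡n a≤N) ⟨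
    (a + e) ∸ i           ≡⟨ cong (λ k → (a + k) ∸ i) (m≡m%n+[m/n]*n e γ) ⟩
    (a + (i + j * γ)) ∸ i ≡⟨ cong (_∸ i) (swap-last a i (j * γ)) ⟩
    (a + j * γ + i) ∸ i   ≡⟨ m+n∸n≡m (a + j * γ) i ⟩
    a + j * γ             ∎
    where
    open ≡-Reasoning
    swap-last : ∀ x y z → x + (y + z) ≡ x + z + y
    swap-last = solve-∀

-- b = d − c where d is b rounded up to a multiple of g + 1, or d = M if that overshoots M.
multiples-upTo-DiffCover : ∀ M g δ → suc M ≤ δ * suc g →
                           DiffCover (M ∷ multiples (suc g) δ) (upTo (suc g)) (suc M)
multiples-upTo-DiffCover M g δ M<δγ {b} (s≤s b≤M) = by-cases (j * γ ≤? M)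
  where
  γ = suc g
  e = b + g
  i = e % γ
  j = e / γ
  i≤g : i ≤ g
  i≤g = ≤-pred (m%n<n e γ)
  jγ≤e : j * γ ≤ e
  jγ≤e = m/n*n≤m e γ
  by-cases : Dec (j * γ ≤ M) →
             ∃₂ λ d c → d ∈ M ∷ multiples γ δ × c ∈ upTo γ × d < suc M × d ≡ b + c
  by-cases (yes jγ≤M) =
    j * γ , g ∸ i , there (∈-map⁺ (_* γ) (∈-upTo⁺ j<δ)) , ∈-upTo⁺ (s≤s (m∸n≤m g i)) ,
    s≤s jγ≤M , jγ≡b+[g∸i]
    where
    j<δ : j < δ
    j<δ = *-cancelʳ-< γ j δ (<-≤-trans (s≤s jγ≤M) M<δγ)
    jγ≡b+[g∸i] : j * γ ≡ b + (g ∸ i)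
    jγ≡b+[g∸i] = begin
      j * γ           ≡⟨ m+n∸m≡n i (j * γ) ⟨
      (i + j * γ) ∸ i ≡⟨ cong (_∸ i) (m≡m%n+[m/n]*n e γ) ⟨
      (b + g) ∸ i     ≡⟨ +-∸-assoc b i≤g ⟩
      b + (g ∸ i)     ∎
      where open ≡-Reasoning
  by-cases (no jγ≰M) =
    M , M ∸ b , here refl , ∈-upTo⁺ (s≤s M∸b≤g) , ≤-refl , sym (m+[n∸m]≡n b≤M)
    where
    M∸b≤g : M ∸ b ≤ g
    M∸b≤g = subst (M ∸ b ≤_) (m+n∸m≡n b g)
              (∸-monoˡ-≤ b (≤-trans (<⇒≤ (≰⇒> jγ≰M)) jγ≤e))

comb-ruler : ∀ N M g β h δ {K} → suc N ≤ β * suc g → suc M ≤ δ * suc h →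
             suc g * (suc h + suc h) + β * suc δ ≤ K →
             Σ (List Point) λ R → Unique R × IsRuler (suc N) (suc M) R × length R ≤ K
comb-ruler N M g β h δ {K} N<βα M<δγ size≤K =
  restrict (suc N) (suc M) L , restrict-Unique (suc N) (suc M) L , product-ruler AB CD DC ,
  ≤-trans (length-product-ruler (suc N) (suc M) A B C D) (subst (_≤ K) (sym sizes) size≤K)
  where
  A = topSegment N (suc g)
  B = multiples (suc g) β
  C = upTo (suc h) ++ topSegment M (suc h)
  D = M ∷ multiples (suc h) δ
  L = cartesianProduct A C ++ cartesianProduct B D
  AB : DiffCover A B (suc N)
  AB = topSegment-multiples-DiffCover N g β N<βα
  CD : DiffCover C D (suc M)
  CD = DiffCover-mono (∈-++⁺ʳ (upTo (suc h))) there (topSegment-multiples-DiffCover M h δ M<δγ)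
  DC : DiffCover D C (suc M)
  DC = DiffCover-mono (λ d∈ → d∈) ∈-++⁺ˡ (multiples-upTo-DiffCover M h δ M<δγ)
  sizes : length A * length C + length B * length D ≡ suc g * (suc h + suc h) + β * suc δ
  sizes = cong₂ _+_
    (cong₂ _*_ (length-topSegment N (suc g))
               (trans (length-++ (upTo (suc h))) (cong₂ _+_ (length-upTo (suc h)) (length-topSegment M (suc h)))))
    (cong₂ _*_ (length-multiples (suc g) β) (cong suc (length-multiples (suc h) δ)))

≤[1+√[2m]]*[1+⌊√[2m]/2⌋] : ∀ m → m ≤ suc (isqrt (2 * m)) * suc ⌊ isqrt (2 * m) /2⌋
≤[1+√[2m]]*[1+⌊√[2m]/2⌋] m = <⇒≤ (*-cancelˡ-< 2 m (suc w * suc v) (begin-strict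
  2 * m                 <⟨ <[1+isqrt]² (2 * m) ⟩
  suc w * suc w         ≤⟨ *-monoʳ-≤ (suc w) (subst (suc w ≤_) (double-suc v) (s≤s (n≤1+⌊n/2⌋+⌊n/2⌋ w))) ⟩
  suc w * (2 * suc v)   ≡⟨ *-comm-2 (suc w) (suc v) ⟩
  2 * (suc w * suc v)   ∎))
  where
  open ≤-Reasoning
  w = isqrt (2 * m)
  v = ⌊ w /2⌋
  double-suc : ∀ x → suc (suc (x + x)) ≡ 2 * suc x
  double-suc = solve-∀
  *-comm-2 : ∀ x y → x * (2 * y) ≡ 2 * (x * y)
  *-comm-2 = solve-∀

comb-size-bound : ∀ p q v w K → 0 < p → w * p ≤ K → v + v ≤ w → w ≤ suc (2 * q) →
                  suc p * (suc v + suc v) + suc p * suc (suc w) ≤ 2 * K + 10 * (p + q)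
comb-size-bound (suc p) q v w K _ wp≤K v+v≤w w≤1+2q = begin
  suc (suc p) * (suc v + suc v) + suc (suc p) * suc (suc w)
    ≡⟨ split-v (suc (suc p)) v w ⟩
  suc (suc p) * (v + v) + suc (suc p) * w + 4 * suc (suc p)
    ≤⟨ +-monoˡ-≤ (4 * suc (suc p)) (+-monoˡ-≤ (suc (suc p) * w) (*-monoʳ-≤ (suc (suc p)) v+v≤w)) ⟩
  suc (suc p) * w + suc (suc p) * w + 4 * suc (suc p)
    ≡⟨ split-w (suc p) w ⟩
  2 * (w * suc p) + 2 * w + 4 * suc (suc p)
    ≤⟨ +-monoˡ-≤ (4 * suc (suc p)) (+-mono-≤ (*-monoʳ-≤ 2 wp≤K) (*-monoʳ-≤ 2 w≤1+2q)) ⟩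
  2 * K + 2 * suc (2 * q) + 4 * suc (suc p)
    ≤⟨ m≤m+n _ (6 * p + 6 * q) ⟩
  2 * K + 2 * suc (2 * q) + 4 * suc (suc p) + (6 * p + 6 * q)
    ≡⟨ collect K p q ⟩
  2 * K + 10 * (suc p + q) ∎
  where
  open ≤-Reasoning
  split-v : ∀ x v w → x * (suc v + suc v) + x * suc (suc w) ≡ x * (v + v) + x * w + 4 * x
  split-v = solve-∀
  split-w : ∀ p w → suc p * w + suc p * w + 4 * suc p ≡ 2 * (w * p) + 2 * w + 4 * suc p
  split-w = solve-∀
  collect : ∀ K p q → 2 * K + 2 * suc (2 * q) + 4 * suc (suc p) + (6 * p + 6 * q) ≡ 2 * K + 10 * (suc p + q)
  collect = solve-∀

M₂-lower-bound : ∀ {n m M} → 0 < n → 0 < m → IsM₂ n m M → 1 ≤ M × 4 * m * n + M ≤ M * M + 2 * (m + n)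
M₂-lower-bound 0<n 0<m ((R , _ , ruler , refl) , _) =
  ruler-nonempty 0<n 0<m ruler , ruler-length-lower-bound 0<n 0<m ruler

ruler⇒M₂≤ : ∀ {n m M K} → IsM₂ n m M →
            (Σ (List Point) λ R → Unique R × IsRuler n m R × length R ≤ K) → M ≤ K
ruler⇒M₂≤ (_ , minimal) (R , unique , ruler , length≤K) = ≤-trans (minimal R unique ruler) length≤K

M₂-upper-bound : ∀ {n m M} → 0 < n → 0 < m → IsM₂ n m M →
                 M ≤ 2 * isqrt (2 * m * n) + 10 * (isqrt n + isqrt m)
M₂-upper-bound {suc n′} {suc m′} _ _ isM₂ = ruler⇒M₂≤ isM₂
  (comb-ruler n′ m′ p (suc p) v (suc w) (<⇒≤ (<[1+isqrt]² n)) (≤[1+√[2m]]*[1+⌊√[2m]/2⌋] m)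
    (comb-size-bound p (isqrt m) v w K (≤isqrt {1} {n} (s≤s z≤n)) (isqrt*isqrt≤isqrt-* (2 * m) n)
                     (⌊n/2⌋+⌊n/2⌋≤n w) (isqrt[2*]≤1+2*isqrt m)))
  where
  n = suc n′
  m = suc m′
  p = isqrt n
  w = isqrt (2 * m)
  v = ⌊ w /2⌋
  K = isqrt (2 * m * n)

theorem10 : Σ ℕ λ C → 0 < C ×
    (∀ (n m : ℕ) → 0 < n → 0 < m → ∀ (M : ℕ) → IsM₂ n m M →
      (1 ≤ M × 4 * m * n + M ≤ M * M + 2 * (m + n)) ×
      M ≤ 2 * isqrt (2 * m * n) + C * (isqrt n + isqrt m))
theorem10 = 10 , z<s , λ n m 0<n 0<m M isM₂ →
  M₂-lower-bound 0<n 0<m isM₂ , M₂-upper-bound 0<n 0<m isM₂
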